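{- Let $R_1=T_1\,i\,(i+1)\,i\,T_2$ and $R_2=T_1\,(i+1)\,i\,(i+1)\,T_2$ be reduced words for the longest element $w_0\in S_n$ ($T_1,T_2$ words, $1\le i\le n-2$), and let $v_1=\mathrm{Dem}(T_1\,i\,T_2)$, $v_2=\mathrm{Dem}(T_1\,(i+1)\,T_2)$. Then $v_1\ne v_2$.
   Context: $S_n$ has simple transpositions $s_i=(i\ i+1)$ and length $\ell$. For a word $R=i_1\cdots i_L$, the Demazure product is $\mathrm{Dem}(R)=e*s_{i_1}*\cdots*s_{i_L}$, where $x*s_i=xs_i$ if $\ell(xs_i)>\ell(x)$ and $x*s_i=x$ otherwise. -}

module Defs where

open import Data.Nat using (ℕ; zero; suc; _+_; _≤_; _<_; _<?_)
open import Data.Fin as F using (Fin)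
open import Data.List as L using (List; []; _∷_; length; foldl; filter)
open import Data.List.Relation.Unary.All using (All)
open import Data.Vec as V using (Vec; []; _∷_; allFin; reverse; toList)
open import Data.Product using (_×_)
open import Relation.Binary.PropositionalEquality using (_≡_)
open import Relation.Nullary using (yes; no)

-- Permutations of S_n in one-line notation: w = [w(1), …, w(n)] (values in Fin n,
-- 0-indexed).  The identity e is [1,…,n].
Perm : ℕ → Set
Perm n = Vec (Fin n) n

e : (n : ℕ) → Perm n
e n = allFin n

w₀ : (n : ℕ) → Perm n
w₀ n = reverse (allFin n)

swapAt : ∀ {A : Set} {m} → ℕ → Vec A m → Vec A m
swapAt zero (x ∷ y ∷ xs) = y ∷ x ∷ xs
swapAt (suc k) (x ∷ xs) = x ∷ swapAt k xs
swapAt _ xs = xs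

-- right multiplication by s_i = (i i+1), paper's 1-indexed letters i ∈ {1,…,n-1}:
-- (x s_i)(j) = x(s_i(j)), i.e. swap positions i and i+1 in one-line notation.
mulS : ∀ {n} → Perm n → ℕ → Perm n
mulS x zero = x          -- never used for valid letters
mulS x (suc k) = swapAt k x

-- Coxeter length ℓ in S_n = number of inversions.
invList : ∀ {n} → List (Fin n) → ℕ
invList [] = 0
invList (x ∷ xs) = length (filter (λ y → y F.<? x) xs) + invList xs

ℓ : ∀ {n} → Perm n → ℕ
ℓ w = invList (toList w)

demStep : ∀ {n} → Perm n → ℕ → Perm n
demStep x i with ℓ x <? ℓ (mulS x i)
... | yes _ = mulS x i
... | no  _ = x

Dem : (n : ℕ) → List ℕ → Perm n
Dem n R = foldl demStep (e n) R

prod : (n : ℕ) → List ℕ → Perm n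
prod n R = foldl mulS (e n) R

ValidWord : ℕ → List ℕ → Set
ValidWord n R = All (λ j → 1 ≤ j × j < n) R

IsReducedWordFor : (n : ℕ) → Perm n → List ℕ → Set
IsReducedWordFor n w R = ValidWord n R × prod n R ≡ w × length R ≡ ℓ w

-- Let u = prod T₁ and let p, q, r be the entries of u in positions i, i+1, i+2. Reducedness of
-- R₁ makes u ascend at i and u s_i s_{i+1}, whose window reads q r p, ascend at i; so p < q < r.
-- Project permutations to 0/1 vectors by marking the entries above q. A Demazure step s_j acts
-- on the projection alone, by sorting positions j, j+1 decreasingly, so the projections of v₁
-- and v₂ arise by running T₂ from those of u s_i and u s_{i+1}, which read 001 and 010 on the
-- window. As T₂ is reduced from y = u s_i s_{i+1} s_i, each of its letters swaps an ascent of y;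
-- tracking the position of every entry of y relative to q along the way yields an invariant that
-- keeps the two 0/1 vectors apart.

module Submission where

open import Defs
open import Data.Nat using (ℕ; suc; _+_; _≤_)
open import Data.List using (List; _∷_; _++_)
open import Relation.Binary.PropositionalEquality using (_≢_)

open import Data.Nat using (zero; _<_; _<?_; s≤s; z≤n)
import Data.Nat.Properties as ℕₚ
open import Algebra.Properties.CommutativeSemigroup ℕₚ.+-commutativeSemigroup using (x∙yz≈y∙xz)
open import Data.Fin as F using (Fin)
import Data.Fin.Properties as Fₚ
open import Data.Bool as 𝔹 using (Bool; true; false; f≤t; b≤b; f<t)
open import Data.Bool.Properties using (≤-minimum)
open import Data.List using ([]; length; foldl; filter)
import Data.List.Properties as Lₚ
open import Data.List.Relation.Binary.Permutation.Propositional using (_↭_; prep; swap; ↭-refl)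
open import Data.List.Relation.Binary.Permutation.Propositional.Properties using (↭-length; filter-↭)
open import Data.Vec using (Vec; []; _∷_; map; tabulate; toList)
open import Data.Vec.Relation.Unary.All using (All; []; _∷_)
open import Data.Vec.Relation.Unary.AllPairs using ([]; _∷_)
open import Data.Vec.Relation.Unary.Unique.Propositional using (Unique)
open import Data.Vec.Relation.Unary.Unique.Propositional.Properties using (tabulate⁺)
open import Data.Empty using (⊥)
open import Data.Product using (_×_; _,_; proj₁; ∃-syntax)
open import Function using (_∘_)
open import Relation.Nullary using (¬_; Dec; yes; no; contradiction)
open import Relation.Binary.Definitions using (Decidable; tri<; tri≈; tri>)
open import Relation.Binary.PropositionalEquality
  using (_≡_; refl; sym; trans; cong; cong₂; subst; ≢-sym; module ≡-Reasoning)

variable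
  A B : Set
  k m n : ℕ

Adjacent : (A → A → Set) → ℕ → Vec A m → Set
Adjacent R zero    (a ∷ b ∷ _) = R a b
Adjacent R (suc k) (_ ∷ v)     = Adjacent R k v
Adjacent R _       _           = ⊥

adjacent? : {R : A → A → Set} → Decidable R → ∀ k (v : Vec A m) → Dec (Adjacent R k v)
adjacent? R? zero    (a ∷ b ∷ _) = R? a b
adjacent? R? (suc k) (_ ∷ v)     = adjacent? R? k v
adjacent? R? zero    []          = no λ ()
adjacent? R? zero    (_ ∷ [])    = no λ ()
adjacent? R? (suc k) []          = no λ ()

module _ {R : A → A → Set} {S : B → B → Set} {f : A → B} where

  adjacent-map : (∀ {a b} → R a b → S (f a) (f b)) →
                 ∀ k (v : Vec A m) → Adjacent R k v → Adjacent S k (map f v)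
  adjacent-map f-mono zero    (a ∷ b ∷ _) r = f-mono r
  adjacent-map f-mono (suc k) (_ ∷ v)     r = adjacent-map f-mono k v r

  adjacent-map⁻ : (∀ {a b} → S (f a) (f b) → R a b) →
                  ∀ k (v : Vec A m) → Adjacent S k (map f v) → Adjacent R k v
  adjacent-map⁻ f-refl zero    (a ∷ b ∷ _) s = f-refl s
  adjacent-map⁻ f-refl (suc k) (_ ∷ v)     s = adjacent-map⁻ f-refl k v s

map-swapAt : (f : A → B) → ∀ k (v : Vec A m) → map f (swapAt k v) ≡ swapAt k (map f v)
map-swapAt f zero    (a ∷ b ∷ v) = refl
map-swapAt f zero    []          = refl
map-swapAt f zero    (a ∷ [])    = refl
map-swapAt f (suc k) []          = refl
map-swapAt f (suc k) (a ∷ v)     = cong (f a ∷_) (map-swapAt f k v)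

toList-swapAt : ∀ k (v : Vec A m) → toList (swapAt k v) ↭ toList v
toList-swapAt zero    (a ∷ b ∷ v) = swap b a ↭-refl
toList-swapAt zero    []          = ↭-refl
toList-swapAt zero    (a ∷ [])    = ↭-refl
toList-swapAt (suc k) []          = ↭-refl
toList-swapAt (suc k) (a ∷ v)     = prep a (toList-swapAt k v)

all-swapAt : {P : A → Set} → ∀ k {v : Vec A m} → All P v → All P (swapAt k v)
all-swapAt zero    (pa ∷ pb ∷ pv) = pb ∷ pa ∷ pv
all-swapAt zero    []             = []
all-swapAt zero    (pa ∷ [])      = pa ∷ []
all-swapAt (suc k) []             = []
all-swapAt (suc k) (pa ∷ pv)      = pa ∷ all-swapAt k pv

unique-swapAt : ∀ k {v : Vec A m} → Unique v → Unique (swapAt k v)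
unique-swapAt zero    ((a≢b ∷ a∉v) ∷ (b∉v ∷ uv)) = (≢-sym a≢b ∷ b∉v) ∷ (a∉v ∷ uv)
unique-swapAt zero    []                         = []
unique-swapAt zero    ([] ∷ [])                  = [] ∷ []
unique-swapAt (suc k) []                         = []
unique-swapAt (suc k) (a∉v ∷ uv)                 = all-swapAt k a∉v ∷ unique-swapAt k uv

data Window {A : Set} : ℕ → Vec A m → A → A → A → Set where
  here  : ∀ {p q r} {v : Vec A m} → Window zero (p ∷ q ∷ r ∷ v) p q r
  there : ∀ {p q r w} {v : Vec A m} → Window k v p q r → Window (suc k) (w ∷ v) p q r

window-exists : ∀ k (u : Vec A m) → 3 + k ≤ m → ∃[ p ] ∃[ q ] ∃[ r ] Window k u p q r
window-exists zero    (p ∷ q ∷ r ∷ _) _              = p , q , r , here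
window-exists zero    (_ ∷ [])        (s≤s ())
window-exists zero    (_ ∷ _ ∷ [])    (s≤s (s≤s ()))
window-exists (suc k) (_ ∷ u)         (s≤s 3+k≤m) with window-exists k u 3+k≤m
... | p , q , r , w = p , q , r , there w

module _ {p q r : A} where

  window-swapAt₀ : {u : Vec A m} → Window k u p q r → Window k (swapAt k u) q p r
  window-swapAt₀ here      = here
  window-swapAt₀ (there w) = there (window-swapAt₀ w)

  window-swapAt₁ : {u : Vec A m} → Window k u p q r → Window k (swapAt (suc k) u) p r q
  window-swapAt₁ here      = here
  window-swapAt₁ (there w) = there (window-swapAt₁ w)

  window-adjacent₀ : {R : A → A → Set} {u : Vec A m} → Window k u p q r → R p q → Adjacent R k u
  window-adjacent₀ here      pq = pq
  window-adjacent₀ (there w) pq = window-adjacent₀ w pq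

  window-adjacent₀⁻ : {R : A → A → Set} {u : Vec A m} → Window k u p q r → Adjacent R k u → R p q
  window-adjacent₀⁻ here      pq = pq
  window-adjacent₀⁻ (there w) pq = window-adjacent₀⁻ w pq

  window-adjacent₁ : {R : A → A → Set} {u : Vec A m} → Window k u p q r → R q r → Adjacent R (suc k) u
  window-adjacent₁ here      qr = qr
  window-adjacent₁ (there w) qr = window-adjacent₁ w qr

  window-all : {P : A → Set} {u : Vec A m} → All P u → Window k u p q r → P q
  window-all (_ ∷ Pq ∷ _) here      = Pq
  window-all (_ ∷ Pu)     (there w) = window-all Pu w

count< : Fin n → List (Fin n) → ℕ
count< x xs = length (filter (F._<? x) xs)

inv : Vec (Fin n) m → ℕ
inv v = invList (toList v)

module _ {x : Fin n} where

  count<-↭ : {xs ys : List (Fin n)} → xs ↭ ys → count< x xs ≡ count< x ys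
  count<-↭ xs↭ys = ↭-length (filter-↭ (F._<? x) xs↭ys)

  count<-accept : {y : Fin n} (xs : List (Fin n)) → y F.< x → count< x (y ∷ xs) ≡ suc (count< x xs)
  count<-accept xs y<x = cong length (Lₚ.filter-accept (F._<? x) y<x)

  count<-reject : {y : Fin n} (xs : List (Fin n)) → ¬ y F.< x → count< x (y ∷ xs) ≡ count< x xs
  count<-reject xs y≮x = cong length (Lₚ.filter-reject (F._<? x) y≮x)

  count<-∷ : (y : Fin n) (xs : List (Fin n)) → count< x xs ≤ count< x (y ∷ xs)
  count<-∷ y xs = by-cases (y F.<? x)
    where
    by-cases : Dec (y F.< x) → count< x xs ≤ count< x (y ∷ xs)
    by-cases (yes y<x) = subst (count< x xs ≤_) (sym (count<-accept xs y<x)) (ℕₚ.n≤1+n _)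
    by-cases (no  y≮x) = ℕₚ.≤-reflexive (sym (count<-reject xs y≮x))

inv-swapAt-ascent : ∀ k (v : Vec (Fin n) m) → Adjacent F._<_ k v → inv (swapAt k v) ≡ suc (inv v)
inv-swapAt-ascent zero (a ∷ b ∷ v) a<b = begin
  count< b (a ∷ L) + (count< a L + inv v)          ≡⟨ cong (_+ _) (count<-accept L a<b) ⟩
  suc (count< b L + (count< a L + inv v))          ≡⟨ cong suc (x∙yz≈y∙xz (count< b L) (count< a L) (inv v)) ⟩
  suc (count< a L + (count< b L + inv v))          ≡⟨ cong (λ c → suc (c + _)) (count<-reject L (Fₚ.<-asym a<b)) ⟨
  suc (count< a (b ∷ L) + (count< b L + inv v))    ∎
  where open ≡-Reasoning
        L = toList v
inv-swapAt-ascent (suc k) (a ∷ v) ascent = begin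
  count< a (toList (swapAt k v)) + inv (swapAt k v) ≡⟨ cong₂ _+_ (count<-↭ (toList-swapAt k v))
                                                                 (inv-swapAt-ascent k v ascent) ⟩
  count< a (toList v) + suc (inv v)                  ≡⟨ ℕₚ.+-suc _ _ ⟩
  suc (count< a (toList v) + inv v)                  ∎
  where open ≡-Reasoning

inv-swapAt-nonascent : ∀ k (v : Vec (Fin n) m) → ¬ Adjacent F._<_ k v → inv (swapAt k v) ≤ inv v
inv-swapAt-nonascent zero (a ∷ b ∷ v) a≮b = begin
  count< b (a ∷ L) + (count< a L + inv v)          ≡⟨ cong (_+ _) (count<-reject L a≮b) ⟩
  count< b L + (count< a L + inv v)                ≡⟨ x∙yz≈y∙xz (count< b L) (count< a L) (inv v) ⟩
  count< a L + (count< b L + inv v)                ≤⟨ ℕₚ.+-monoˡ-≤ _ (count<-∷ b L) ⟩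
  count< a (b ∷ L) + (count< b L + inv v)          ∎
  where open ℕₚ.≤-Reasoning
        L = toList v
inv-swapAt-nonascent zero    []          _ = ℕₚ.≤-refl
inv-swapAt-nonascent zero    (a ∷ [])    _ = ℕₚ.≤-refl
inv-swapAt-nonascent (suc k) []          _ = ℕₚ.≤-refl
inv-swapAt-nonascent (suc k) (a ∷ v) nonascent =
  ℕₚ.+-mono-≤ (ℕₚ.≤-reflexive (count<-↭ (toList-swapAt k v))) (inv-swapAt-nonascent k v nonascent)

inv-swapAt-≤ : ∀ k (v : Vec (Fin n) m) → inv (swapAt k v) ≤ suc (inv v)
inv-swapAt-≤ k v with adjacent? F._<?_ k v
... | yes ascent    = ℕₚ.≤-reflexive (inv-swapAt-ascent k v ascent)
... | no  nonascent = ℕₚ.m≤n⇒m≤1+n (inv-swapAt-nonascent k v nonascent)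

ascent-of-inv-swapAt : ∀ k (v : Vec (Fin n) m) → inv (swapAt k v) ≡ suc (inv v) → Adjacent F._<_ k v
ascent-of-inv-swapAt k v inv-suc with adjacent? F._<?_ k v
... | yes ascent    = ascent
... | no  nonascent =
  contradiction (subst (_≤ inv v) inv-suc (inv-swapAt-nonascent k v nonascent)) (ℕₚ.<-irrefl refl)

ℓ-mulS-≤ : (x : Perm n) (j : ℕ) → ℓ (mulS x j) ≤ suc (ℓ x)
ℓ-mulS-≤ x zero    = ℕₚ.n≤1+n (ℓ x)
ℓ-mulS-≤ x (suc k) = inv-swapAt-≤ k x

ℓ-foldl-mulS-≤ : (x : Perm n) (T : List ℕ) → ℓ (foldl mulS x T) ≤ ℓ x + length T
ℓ-foldl-mulS-≤ x []      = ℕₚ.≤-reflexive (sym (ℕₚ.+-identityʳ (ℓ x)))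
ℓ-foldl-mulS-≤ x (j ∷ T) = begin
  ℓ (foldl mulS (mulS x j) T) ≤⟨ ℓ-foldl-mulS-≤ (mulS x j) T ⟩
  ℓ (mulS x j) + length T     ≤⟨ ℕₚ.+-monoˡ-≤ (length T) (ℓ-mulS-≤ x j) ⟩
  suc (ℓ x) + length T        ≡⟨ ℕₚ.+-suc (ℓ x) (length T) ⟨
  ℓ x + length (j ∷ T)        ∎
  where open ℕₚ.≤-Reasoning

LengthAdditive : Perm n → List ℕ → Set
LengthAdditive x T = ℓ (foldl mulS x T) ≡ ℓ x + length T

lengthAdditive-∷⁻ : (x : Perm n) (j : ℕ) (T : List ℕ) → LengthAdditive x (j ∷ T) →
                    ℓ (mulS x j) ≡ suc (ℓ x) × LengthAdditive (mulS x j) T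
lengthAdditive-∷⁻ x j T additive =
  ℓ-step , trans additive (trans (ℕₚ.+-suc (ℓ x) (length T)) (cong (_+ length T) (sym ℓ-step)))
  where
  open ℕₚ.≤-Reasoning
  lower : suc (ℓ x) + length T ≤ ℓ (mulS x j) + length T
  lower = begin
    suc (ℓ x) + length T        ≡⟨ ℕₚ.+-suc (ℓ x) (length T) ⟨
    ℓ x + length (j ∷ T)        ≡⟨ additive ⟨
    ℓ (foldl mulS (mulS x j) T) ≤⟨ ℓ-foldl-mulS-≤ (mulS x j) T ⟩
    ℓ (mulS x j) + length T     ∎
  ℓ-step : ℓ (mulS x j) ≡ suc (ℓ x)
  ℓ-step = ℕₚ.≤-antisym (ℓ-mulS-≤ x j) (ℕₚ.+-cancelʳ-≤ (length T) _ _ lower)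

lengthAdditive-++⁻ : (x : Perm n) (T U : List ℕ) → LengthAdditive x (T ++ U) →
                     LengthAdditive x T × LengthAdditive (foldl mulS x T) U
lengthAdditive-++⁻ x []      U additive = sym (ℕₚ.+-identityʳ (ℓ x)) , additive
lengthAdditive-++⁻ x (j ∷ T) U additive with lengthAdditive-∷⁻ x j (T ++ U) additive
... | ℓ-step , additive′ with lengthAdditive-++⁻ (mulS x j) T U additive′
...   | additiveT , additiveU =
  trans additiveT (trans (cong (_+ length T) ℓ-step) (sym (ℕₚ.+-suc (ℓ x) (length T)))) , additiveU

count<-tabulate : (x : Fin n) (g : Fin m → Fin n) → (∀ i → ¬ g i F.< x) → count< x (toList (tabulate g)) ≡ 0
count<-tabulate {m = zero}  x g g≮x = refl
count<-tabulate {m = suc m} x g g≮x =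
  trans (count<-reject _ (g≮x F.zero)) (count<-tabulate x (λ i → g (F.suc i)) (λ i → g≮x (F.suc i)))

inv-tabulate : (f : Fin m → Fin n) → (∀ {i j} → i F.< j → f i F.< f j) → inv (tabulate f) ≡ 0
inv-tabulate {m = zero}  f f-mono = refl
inv-tabulate {m = suc m} f f-mono =
  cong₂ _+_ (count<-tabulate (f F.zero) (λ i → f (F.suc i)) (λ i → Fₚ.<-asym (f-mono (s≤s z≤n))))
            (inv-tabulate (λ i → f (F.suc i)) (λ i<j → f-mono (s≤s i<j)))

ℓ-e : (n : ℕ) → ℓ (e n) ≡ 0
ℓ-e n = inv-tabulate {m = n} (λ i → i) (λ i<j → i<j)

reducedWord⇒lengthAdditive : {w : Perm n} {R : List ℕ} → IsReducedWordFor n w R → LengthAdditive (e n) R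
reducedWord⇒lengthAdditive {n = n} {R = R} (_ , prod≡w , length≡ℓw) =
  trans (cong ℓ prod≡w) (trans (sym length≡ℓw) (cong (_+ length R) (sym (ℓ-e n))))

unique-foldl-mulS : (x : Perm n) (T : List ℕ) → Unique x → Unique (foldl mulS x T)
unique-foldl-mulS x []          unique = unique
unique-foldl-mulS x (zero ∷ T)  unique = unique-foldl-mulS x T unique
unique-foldl-mulS x (suc k ∷ T) unique = unique-foldl-mulS (swapAt k x) T (unique-swapAt k unique)

unique-prod : (n : ℕ) (T : List ℕ) → Unique (prod n T)
unique-prod n T = unique-foldl-mulS (e n) T (tabulate⁺ (λ i≡j → i≡j))

demStep-< : (x : Perm n) (j : ℕ) → ℓ x < ℓ (mulS x j) → demStep x j ≡ mulS x j
demStep-< x j ℓ< with ℓ x <? ℓ (mulS x j)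
... | yes _ = refl
... | no ℓ≮ = contradiction ℓ< ℓ≮

demStep-≮ : (x : Perm n) (j : ℕ) → ¬ ℓ x < ℓ (mulS x j) → demStep x j ≡ x
demStep-≮ x j ℓ≮ with ℓ x <? ℓ (mulS x j)
... | yes ℓ< = contradiction ℓ< ℓ≮
... | no _   = refl

foldl-demStep-additive : (x : Perm n) (T : List ℕ) → LengthAdditive x T → foldl demStep x T ≡ foldl mulS x T
foldl-demStep-additive x []      _        = refl
foldl-demStep-additive x (j ∷ T) additive with lengthAdditive-∷⁻ x j T additive
... | ℓ-step , additive′ rewrite demStep-< x j (ℕₚ.≤-reflexive (sym ℓ-step)) =
  foldl-demStep-additive (mulS x j) T additive′

Dem-++-ascent : (T U : List ℕ) → LengthAdditive (e n) T → Adjacent F._<_ k (prod n T) →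
                Dem n (T ++ suc k ∷ U) ≡ foldl demStep (swapAt k (prod n T)) U
Dem-++-ascent {n = n} {k = k} T U additive ascent = begin
  Dem n (T ++ suc k ∷ U)                           ≡⟨ Lₚ.foldl-++ demStep (e n) T (suc k ∷ U) ⟩
  foldl demStep (demStep (Dem n T) (suc k)) U      ≡⟨ cong (λ x → foldl demStep (demStep x (suc k)) U)
                                                          (foldl-demStep-additive (e n) T additive) ⟩
  foldl demStep (demStep (prod n T) (suc k)) U     ≡⟨ cong (λ x → foldl demStep x U)
                                                          (demStep-< (prod n T) (suc k) ℓ<) ⟩
  foldl demStep (swapAt k (prod n T)) U            ∎
  where
  open ≡-Reasoning
  ℓ< : ℓ (prod n T) < ℓ (swapAt k (prod n T))
  ℓ< = ℕₚ.≤-reflexive (sym (inv-swapAt-ascent k (prod n T) ascent))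

data Level : Set where
  below equal above : Level

data _≤ˡ_ : Level → Level → Set where
  below≤      : ∀ {l} → below ≤ˡ l
  equal≤equal : equal ≤ˡ equal
  ≤above      : ∀ {l} → l ≤ˡ above

level : Fin n → Fin n → Level
level q d with Fₚ.<-cmp q d
... | tri< _ _ _ = above
... | tri≈ _ _ _ = equal
... | tri> _ _ _ = below

isAboveˡ : Level → Bool
isAboveˡ above = true
isAboveˡ _     = false

isAbove : Fin n → Fin n → Bool
isAbove q d = isAboveˡ (level q d)

isAboveˡ-mono : {l l′ : Level} → l ≤ˡ l′ → isAboveˡ l 𝔹.≤ isAboveˡ l′
isAboveˡ-mono          below≤      = ≤-minimum _
isAboveˡ-mono          equal≤equal = b≤b
isAboveˡ-mono {below}  ≤above      = f≤t
isAboveˡ-mono {equal}  ≤above      = f≤t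
isAboveˡ-mono {above}  ≤above      = b≤b

module _ (q : Fin n) where

  level-above : {d : Fin n} → q F.< d → level q d ≡ above
  level-above {d} q<d with Fₚ.<-cmp q d
  ... | tri< _ _ _    = refl
  ... | tri≈ q≮d _ _  = contradiction q<d q≮d
  ... | tri> q≮d _ _  = contradiction q<d q≮d

  level-below : {d : Fin n} → d F.< q → level q d ≡ below
  level-below {d} d<q with Fₚ.<-cmp q d
  ... | tri< _ _ d≮q  = contradiction d<q d≮q
  ... | tri≈ _ _ d≮q  = contradiction d<q d≮q
  ... | tri> _ _ _    = refl

  level-equal : level q q ≡ equal
  level-equal with Fₚ.<-cmp q q
  ... | tri< q<q _ _ = contradiction q<q (Fₚ.<-irrefl refl)
  ... | tri≈ _ _ _   = refl
  ... | tri> _ _ q<q = contradiction q<q (Fₚ.<-irrefl refl)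

  level-mono : {a b : Fin n} → a F.≤ b → level q a ≤ˡ level q b
  level-mono {a} {b} a≤b with Fₚ.<-cmp q a | Fₚ.<-cmp q b
  ... | tri< _ _ _   | tri< _ _ _   = ≤above
  ... | tri< q<a _ _ | tri≈ _ q≡b _ =
    contradiction (ℕₚ.<-≤-trans q<a (subst (a F.≤_) (sym q≡b) a≤b)) (Fₚ.<-irrefl refl)
  ... | tri< q<a _ _ | tri> _ _ b<q =
    contradiction (ℕₚ.<-trans (ℕₚ.<-≤-trans q<a a≤b) b<q) (Fₚ.<-irrefl refl)
  ... | tri≈ _ _ _   | tri< _ _ _   = ≤above
  ... | tri≈ _ _ _   | tri≈ _ _ _   = equal≤equal
  ... | tri≈ _ q≡a _ | tri> _ _ b<q =
    contradiction (ℕₚ.≤-<-trans (subst (F._≤ b) (sym q≡a) a≤b) b<q) (Fₚ.<-irrefl refl)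
  ... | tri> _ _ _   | _            = below≤

  isAbove-mono : {a b : Fin n} → a F.≤ b → isAbove q a 𝔹.≤ isAbove q b
  isAbove-mono a≤b = isAboveˡ-mono (level-mono a≤b)

  isAbove-reflects-< : {a b : Fin n} → isAbove q a 𝔹.< isAbove q b → a F.< b
  isAbove-reflects-< {a} {b} with Fₚ.<-cmp q a | Fₚ.<-cmp q b
  ... | tri< _ _ _   | _            = λ ()
  ... | tri≈ _ q≡a _ | tri< q<b _ _ = λ where f<t → subst (F._< b) q≡a q<b
  ... | tri> _ _ a<q | tri< q<b _ _ = λ where f<t → Fₚ.<-trans a<q q<b
  ... | _            | tri≈ _ _ _   = λ ()
  ... | _            | tri> _ _ _   = λ ()

descendAt : ℕ → Vec Bool m → Vec Bool m
descendAt zero    (false ∷ true ∷ bs) = true ∷ false ∷ bs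
descendAt (suc k) (b ∷ bs)            = b ∷ descendAt k bs
descendAt _       bs                  = bs

descendAt-≤ : ∀ k (bs : Vec Bool m) → Adjacent 𝔹._≤_ k bs → descendAt k bs ≡ swapAt k bs
descendAt-≤ zero    (false ∷ true ∷ bs)  f≤t    = refl
descendAt-≤ zero    (false ∷ false ∷ bs) b≤b    = refl
descendAt-≤ zero    (true ∷ true ∷ bs)   b≤b    = refl
descendAt-≤ (suc k) (b ∷ bs)             ascent = cong (b ∷_) (descendAt-≤ k bs ascent)

descendAt-≮ : ∀ k (bs : Vec Bool m) → ¬ Adjacent 𝔹._<_ k bs → descendAt k bs ≡ bs
descendAt-≮ zero    (false ∷ true ∷ bs)  b≮b′      = contradiction f<t b≮b′
descendAt-≮ zero    (false ∷ false ∷ bs) _         = refl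
descendAt-≮ zero    (true ∷ bs)          _         = refl
descendAt-≮ zero    []                   _         = refl
descendAt-≮ zero    (false ∷ [])         _         = refl
descendAt-≮ (suc k) []                   _         = refl
descendAt-≮ (suc k) (b ∷ bs)             nonascent = cong (b ∷_) (descendAt-≮ k bs nonascent)

isAbove-demStep : (q : Fin n) (x : Perm n) (k : ℕ) →
                  map (isAbove q) (demStep x (suc k)) ≡ descendAt k (map (isAbove q) x)
isAbove-demStep q x k with adjacent? F._<?_ k x
... | yes ascent = begin
  map (isAbove q) (demStep x (suc k))  ≡⟨ cong (map (isAbove q)) (demStep-< x (suc k) ℓ<) ⟩
  map (isAbove q) (swapAt k x)         ≡⟨ map-swapAt (isAbove q) k x ⟩
  swapAt k (map (isAbove q) x)         ≡⟨ descendAt-≤ k _ projection-ascends ⟨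
  descendAt k (map (isAbove q) x)      ∎
  where
  open ≡-Reasoning
  ℓ< : ℓ x < ℓ (swapAt k x)
  ℓ< = ℕₚ.≤-reflexive (sym (inv-swapAt-ascent k x ascent))
  projection-ascends : Adjacent 𝔹._≤_ k (map (isAbove q) x)
  projection-ascends = adjacent-map (λ a<b → isAbove-mono q (ℕₚ.<⇒≤ a<b)) k x ascent
... | no nonascent = begin
  map (isAbove q) (demStep x (suc k))  ≡⟨ cong (map (isAbove q)) (demStep-≮ x (suc k) ℓ≮) ⟩
  map (isAbove q) x                    ≡⟨ descendAt-≮ k _ (nonascent ∘ adjacent-map⁻ (isAbove-reflects-< q) k x) ⟨
  descendAt k (map (isAbove q) x)      ∎
  where
  open ≡-Reasoning
  ℓ≮ : ¬ ℓ x < ℓ (swapAt k x)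
  ℓ≮ ℓ< = ℕₚ.<-irrefl refl (ℕₚ.<-≤-trans ℓ< (inv-swapAt-nonascent k x nonascent))

-- as and bs are the projections of the two Demazure products, cs the levels of the ordinary
-- product; the index counts the marked positions still to be read.
data Aligned : ℕ → Vec Bool m → Vec Bool m → Vec Level m → Set where
  []         : Aligned 0 [] [] []
  below∷     : ∀ {s} {as bs : Vec Bool m} {cs} →
               Aligned s as bs cs → Aligned s (false ∷ as) (false ∷ bs) (below ∷ cs)
  above∷     : ∀ {s} {as bs : Vec Bool m} {cs} →
               Aligned s as bs cs → Aligned s (true ∷ as) (true ∷ bs) (above ∷ cs)
  markAbove∷ : {as bs : Vec Bool m} {cs : Vec Level m} →
               Aligned 2 as bs cs → Aligned 3 (false ∷ as) (false ∷ bs) (above ∷ cs)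
  markEqual∷ : {as bs : Vec Bool m} {cs : Vec Level m} →
               Aligned 1 as bs cs → Aligned 2 (false ∷ as) (true ∷ bs) (equal ∷ cs)
  markBelow∷ : {as bs : Vec Bool m} {cs : Vec Level m} →
               Aligned 0 as bs cs → Aligned 1 (true ∷ as) (false ∷ bs) (below ∷ cs)

aligned-descendAt : ∀ {s} k {as bs : Vec Bool m} {cs} → Aligned s as bs cs → Adjacent _≤ˡ_ k cs →
                    Aligned s (descendAt k as) (descendAt k bs) (swapAt k cs)
aligned-descendAt zero    (below∷ (below∷ al))         _ = below∷ (below∷ al)
aligned-descendAt zero    (below∷ (above∷ al))         _ = above∷ (below∷ al)
aligned-descendAt zero    (below∷ (markAbove∷ al))     _ = markAbove∷ (below∷ al)
aligned-descendAt zero    (below∷ (markEqual∷ al))     _ = markEqual∷ (below∷ al)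
aligned-descendAt zero    (below∷ (markBelow∷ al))     _ = markBelow∷ (below∷ al)
aligned-descendAt zero    (above∷ (above∷ al))         _ = above∷ (above∷ al)
aligned-descendAt zero    (above∷ (markAbove∷ al))     _ = above∷ (markAbove∷ al)
aligned-descendAt zero    (markAbove∷ (above∷ al))     _ = above∷ (markAbove∷ al)
aligned-descendAt zero    (markEqual∷ (above∷ al))     _ = above∷ (markEqual∷ al)
aligned-descendAt zero    (markBelow∷ (below∷ al))     _ = markBelow∷ (below∷ al)
aligned-descendAt zero    (markBelow∷ (above∷ al))     _ = above∷ (markBelow∷ al)
aligned-descendAt zero    (above∷ (below∷ _))          ()
aligned-descendAt zero    (above∷ (markEqual∷ _))      ()
aligned-descendAt zero    (above∷ (markBelow∷ _))      ()
aligned-descendAt zero    (markAbove∷ (below∷ _))      ()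
aligned-descendAt zero    (markAbove∷ (markEqual∷ _))  ()
aligned-descendAt zero    (markEqual∷ (below∷ _))      ()
aligned-descendAt zero    (markEqual∷ (markBelow∷ _))  ()
aligned-descendAt zero    []                           ()
aligned-descendAt zero    (below∷ [])                  ()
aligned-descendAt zero    (above∷ [])                  ()
aligned-descendAt zero    (markBelow∷ [])              ()
aligned-descendAt (suc k) []                           ()
aligned-descendAt (suc k) (below∷ al)     ascent = below∷ (aligned-descendAt k al ascent)
aligned-descendAt (suc k) (above∷ al)     ascent = above∷ (aligned-descendAt k al ascent)
aligned-descendAt (suc k) (markAbove∷ al) ascent = markAbove∷ (aligned-descendAt k al ascent)
aligned-descendAt (suc k) (markEqual∷ al) ascent = markEqual∷ (aligned-descendAt k al ascent)
aligned-descendAt (suc k) (markBelow∷ al) ascent = markBelow∷ (aligned-descendAt k al ascent)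

aligned-≢ : ∀ {s} {as bs : Vec Bool m} {cs} → Aligned (suc s) as bs cs → as ≢ bs
aligned-≢ (below∷ al)     refl = aligned-≢ al refl
aligned-≢ (above∷ al)     refl = aligned-≢ al refl
aligned-≢ (markAbove∷ al) refl = aligned-≢ al refl
aligned-≢ (markEqual∷ al) ()
aligned-≢ (markBelow∷ al) ()

module _ (q : Fin n) where

  aligned-Dem : ∀ {s} (x₁ x₂ y : Perm n) (T : List ℕ) → LengthAdditive y T →
    Aligned s (map (isAbove q) x₁) (map (isAbove q) x₂) (map (level q) y) →
    Aligned s (map (isAbove q) (foldl demStep x₁ T)) (map (isAbove q) (foldl demStep x₂ T))
              (map (level q) (foldl mulS y T))
  aligned-Dem x₁ x₂ y []          _        al = al
  aligned-Dem x₁ x₂ y (zero ∷ T)  additive _  =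
    contradiction (sym (proj₁ (lengthAdditive-∷⁻ y zero T additive))) ℕₚ.1+n≢n
  aligned-Dem {s} x₁ x₂ y (suc k ∷ T) additive al with lengthAdditive-∷⁻ y (suc k) T additive
  ... | ℓ-step , additive′ =
    aligned-Dem (demStep x₁ (suc k)) (demStep x₂ (suc k)) (swapAt k y) T additive′ al′
    where
    levels-ascend : Adjacent _≤ˡ_ k (map (level q) y)
    levels-ascend = adjacent-map (λ a<b → level-mono q (ℕₚ.<⇒≤ a<b)) k y (ascent-of-inv-swapAt k y ℓ-step)
    al′ : Aligned s (map (isAbove q) (demStep x₁ (suc k))) (map (isAbove q) (demStep x₂ (suc k)))
                    (map (level q) (swapAt k y))
    al′ rewrite isAbove-demStep q x₁ k | isAbove-demStep q x₂ k | map-swapAt (level q) k y =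
      aligned-descendAt k al levels-ascend

  aligned-∷ : ∀ {s} {w : Fin n} {as bs : Vec Bool m} {cs} → q ≢ w → Aligned s as bs cs →
              Aligned s (isAbove q w ∷ as) (isAbove q w ∷ bs) (level q w ∷ cs)
  aligned-∷ {w = w} q≢w al with Fₚ.<-cmp q w
  ... | tri< _ _ _   = above∷ al
  ... | tri≈ _ q≡w _ = contradiction q≡w q≢w
  ... | tri> _ _ _   = below∷ al

  aligned-untouched : (v : Vec (Fin n) m) → All (q ≢_) v →
                      Aligned 0 (map (isAbove q) v) (map (isAbove q) v) (map (level q) v)
  aligned-untouched []      []           = []
  aligned-untouched (w ∷ v) (q≢w ∷ q∉v) = aligned-∷ q≢w (aligned-untouched v q∉v)

  aligned-initial : ∀ {k p r} {u : Vec (Fin n) m} → Window k u p q r → p F.< q → q F.< r → Unique u →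
    Aligned 3 (map (isAbove q) (swapAt k u)) (map (isAbove q) (swapAt (suc k) u))
              (map (level q) (swapAt k (swapAt (suc k) (swapAt k u))))
  aligned-initial {u = p ∷ _ ∷ r ∷ v} here p<q q<r (_ ∷ (_ ∷ q∉v) ∷ _)
    rewrite level-equal q | level-below q p<q | level-above q q<r =
    markAbove∷ (markEqual∷ (markBelow∷ (aligned-untouched v q∉v)))
  aligned-initial (there window) p<q q<r (w∉v ∷ unique) =
    aligned-∷ (≢-sym (window-all w∉v window)) (aligned-initial window p<q q<r unique)

braid-ascents : {u : Perm n} {p q r : Fin n} (T : List ℕ) → Window k u p q r →
                LengthAdditive u (suc k ∷ suc (suc k) ∷ suc k ∷ T) →
                p F.< q × q F.< r × LengthAdditive (swapAt k (swapAt (suc k) (swapAt k u))) T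
braid-ascents {k = k} {u = u} T window additive
  with lengthAdditive-∷⁻ u (suc k) (suc (suc k) ∷ suc k ∷ T) additive
... | ℓ-step₁ , additive₁ with lengthAdditive-∷⁻ (swapAt k u) (suc (suc k)) (suc k ∷ T) additive₁
... | _ , additive₂ with lengthAdditive-∷⁻ (swapAt (suc k) (swapAt k u)) (suc k) T additive₂
... | ℓ-step₃ , additive₃ =
  window-adjacent₀⁻ window (ascent-of-inv-swapAt k u ℓ-step₁) ,
  window-adjacent₀⁻ (window-swapAt₁ (window-swapAt₀ window)) (ascent-of-inv-swapAt k _ ℓ-step₃) ,
  additive₃

corollary3p20 : (n i : ℕ) (T₁ T₂ : List ℕ) → 1 ≤ i → i + 2 ≤ n →
    IsReducedWordFor n (w₀ n) (T₁ ++ i ∷ suc i ∷ i ∷ T₂) →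
    IsReducedWordFor n (w₀ n) (T₁ ++ suc i ∷ i ∷ suc i ∷ T₂) →
    Dem n (T₁ ++ i ∷ T₂) ≢ Dem n (T₁ ++ suc i ∷ T₂)
corollary3p20 n zero    T₁ T₂ ()
corollary3p20 n (suc k) T₁ T₂ _ i+2≤n reduced₁ _ Dem≡
  with lengthAdditive-++⁻ (e n) T₁ (suc k ∷ suc (suc k) ∷ suc k ∷ T₂) (reducedWord⇒lengthAdditive reduced₁)
     | window-exists k (prod n T₁) (subst (_≤ n) (ℕₚ.+-comm (suc k) 2) i+2≤n)
... | additiveT₁ , additiveBraid | p , q , r , window with braid-ascents T₂ window additiveBraid
... | p<q , q<r , additiveT₂ =
  aligned-≢ (aligned-Dem q _ _ _ T₂ additiveT₂ (aligned-initial q window p<q q<r (unique-prod n T₁)))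
            (cong (map (isAbove q)) (trans (sym Dem₁) (trans Dem≡ Dem₂)))
  where
  Dem₁ : Dem n (T₁ ++ suc k ∷ T₂) ≡ foldl demStep (swapAt k (prod n T₁)) T₂
  Dem₁ = Dem-++-ascent T₁ T₂ additiveT₁ (window-adjacent₀ window p<q)
  Dem₂ : Dem n (T₁ ++ suc (suc k) ∷ T₂) ≡ foldl demStep (swapAt (suc k) (prod n T₁)) T₂
  Dem₂ = Dem-++-ascent T₁ T₂ additiveT₁ (window-adjacent₁ window q<r)
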